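{- There exists a deterministic algorithm that, given any pairwise disjoint subsets $A,B,C \subset V(G)$ of any graph $G$ with $n=|V(G)|$, access to the TIS oracle of $G$, and a threshold parameter $\tau \in \mathbb{N}$, decides whether $t(A,B,C) \leq \tau$ using $\mathcal{O}(\tau \log n)$ TIS queries.
   Context: For pairwise disjoint non-empty $A,B,C\subseteq V(G)$, $t(A,B,C)$ is the number of triangles of $G$ with exactly one vertex in each of $A,B,C$. The TIS (Tripartite Independent Set) oracle takes pairwise disjoint non-empty $V_1,V_2,V_3\subseteq V(G)$ and answers YES iff $t(V_1,V_2,V_3)\neq 0$. -}

module Defs where

open import Data.Nat using (ℕ; zero; suc; _+_; _≡ᵇ_)
open import Data.Bool using (Bool; true; false; not; _∧_; if_then_else_)
open import Data.Fin using (Fin)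
open import Data.Fin.Subset using (Subset; _∩_; Empty; Nonempty)
open import Data.Vec using (lookup)
open import Data.List using (List; map; allFin)
open import Data.Nat.ListAction using (sum)
open import Data.Product using (_×_)
open import Relation.Binary.PropositionalEquality using (_≡_)

record Graph (n : ℕ) : Set where
  field
    adj    : Fin n → Fin n → Bool
    sym    : ∀ u v → adj u v ≡ adj v u
    irrefl : ∀ v → adj v v ≡ false
open Graph public

Disjoint : ∀ {n} → Subset n → Subset n → Set
Disjoint p q = Empty (p ∩ q)

PairwiseDisjoint : ∀ {n} → Subset n → Subset n → Subset n → Set
PairwiseDisjoint A B C = Disjoint A B × Disjoint B C × Disjoint A C

ValidQuery : ∀ {n} → Subset n → Subset n → Subset n → Set
ValidQuery V₁ V₂ V₃ =
  Nonempty V₁ × Nonempty V₂ × Nonempty V₃ × PairwiseDisjoint V₁ V₂ V₃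

-- t(A,B,C): number of triangles with exactly one vertex in each of A,B,C.
-- For pairwise disjoint A,B,C such triangles are in bijection with the
-- triples (a,b,c) ∈ A×B×C that are pairwise adjacent, which we count.
isTri : ∀ {n} → Graph n → Subset n → Subset n → Subset n →
        Fin n → Fin n → Fin n → ℕ
isTri G A B C a b c =
  if lookup A a ∧ lookup B b ∧ lookup C c
     ∧ adj G a b ∧ adj G b c ∧ adj G a c
  then 1 else 0

t : ∀ {n} → Graph n → Subset n → Subset n → Subset n → ℕ
t {n} G A B C =
  sum (map (λ a → sum (map (λ b → sum (map (λ c → isTri G A B C a b c)
         (allFin n))) (allFin n))) (allFin n))

TIS : ∀ {n} → Graph n → Subset n → Subset n → Subset n → Bool
TIS G V₁ V₂ V₃ = not (t G V₁ V₂ V₃ ≡ᵇ 0)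

-- Deterministic algorithms with TIS-oracle access, modelled as decision
-- trees: each internal node asks a valid TIS query and branches on the answer;
-- leaves output the Boolean decision.
data QTree (n : ℕ) : Set where
  leaf  : Bool → QTree n
  query : (V₁ V₂ V₃ : Subset n) → ValidQuery V₁ V₂ V₃ →
          (onYes onNo : QTree n) → QTree n

run : ∀ {n} → Graph n → QTree n → Bool
run G (leaf b) = b
run G (query V₁ V₂ V₃ _ y n) = if TIS G V₁ V₂ V₃ then run G y else run G n

queries : ∀ {n} → Graph n → QTree n → ℕ
queries G (leaf b) = 0
queries G (query V₁ V₂ V₃ _ y n) =
  suc (if TIS G V₁ V₂ V₃ then queries G y else queries G n)

-- Count triangles only up to the cap τ + 1, by recursion over a subdivision of
-- (A, B, C): each of A, B, C is halved ⌈log₂ n⌉ times along the binary digits of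
-- the vertex indices, so that at the bottom every part is a single vertex and
-- a YES answer means exactly one triangle. Each part is first tested by one TIS
-- query and discarded on NO; on YES its two halves are counted, the second one
-- only up to the cap left over by the first. By induction on the depth d, with
-- m = min(cap, t) the search costs at most 1 + 2dm queries: a YES node pays its
-- own query plus 1 + 2(d-1)m₁ and 1 + 2(d-1)m₂ for its halves, where
-- m₁ + m₂ = m ≥ 1. With d = 3⌈log₂ n⌉ this is O(τ log n).

module Submission where

open import Defs hiding (sym)
open import Data.Nat using (ℕ; zero; suc; _+_; _*_; _∸_; _⊓_; _≤_; _<_; _≤ᵇ_; _≡ᵇ_; z≤n; s≤s; ⌊_/2⌋)
open import Data.Nat.Properties
open import Data.Nat.Logarithm using (⌈log₂_⌉)
open import Data.Nat.Logarithm.Core using (⌈log2⌉)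
open import Data.Nat.Induction using (<-wellFounded)
open import Data.Nat.ListAction using (sum)
open import Data.Nat.Tactic.RingSolver using (solve-∀)
open import Algebra.Properties.CommutativeSemigroup +-commutativeSemigroup using (interchange)
open import Data.Bool using (Bool; true; false; not; T; _∧_; _∨_; if_then_else_)
open import Data.Bool.Properties using (∧-conicalˡ; ∧-conicalʳ; ∧-identityʳ; ∧-distribˡ-∨)
open import Data.Fin using (Fin; toℕ)
open import Data.Fin.Properties using (toℕ<n; toℕ-injective)
open import Data.Fin.Subset using (Subset; _∈_; _⊆_; _∩_; Nonempty)
open import Data.Fin.Subset.Properties using (nonempty?; x∈p∩q⁺; x∈p∩q⁻)
open import Data.Vec using (lookup; tabulate)
open import Data.Vec.Properties using (lookup∘tabulate; tabulate∘lookup; tabulate-cong; lookup⇒[]=; []=⇒lookup)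
open import Data.List using ([]; _∷_; map; allFin)
open import Data.List.Relation.Unary.All using (All; []; _∷_)
open import Data.List.Relation.Unary.AllPairs using ([]; _∷_)
open import Data.List.Relation.Unary.Unique.Propositional using (Unique)
open import Data.List.Relation.Unary.Unique.Propositional.Properties using (allFin⁺)
open import Data.Product using (Σ-syntax; ∃; _×_; _,_; proj₁; proj₂)
open import Data.Unit using (tt)
open import Function using (_∘_)
open import Induction.WellFounded using (Acc; acc)
open import Relation.Nullary using (yes; no; contradiction)
open import Relation.Nullary.Decidable using (Dec; _×-dec_; ¬?)
open import Relation.Binary.PropositionalEquality

ind : Bool → ℕ
ind b = if b then 1 else 0

module _ {A : Set} where

  sum-map-+ : {f g h : A → ℕ} → (∀ x → f x ≡ g x + h x) →
              ∀ xs → sum (map f xs) ≡ sum (map g xs) + sum (map h xs)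
  sum-map-+ e []       = refl
  sum-map-+ {f} {g} {h} e (x ∷ xs) = begin
    f x + sum (map f xs)                             ≡⟨ cong₂ _+_ (e x) (sum-map-+ e xs) ⟩
    (g x + h x) + (sum (map g xs) + sum (map h xs))  ≡⟨ interchange (g x) (h x) _ _ ⟩
    (g x + sum (map g xs)) + (h x + sum (map h xs))  ∎
    where open ≡-Reasoning

  sum-map-≢0 : (f : A → ℕ) → ∀ xs → sum (map f xs) ≢ 0 → ∃ λ x → f x ≢ 0
  sum-map-≢0 f [] ne = contradiction refl ne
  sum-map-≢0 f (x ∷ xs) ne with f x in e
  ... | zero  = sum-map-≢0 f xs ne
  ... | suc _ = x , λ fx≡0 → 1+n≢0 (trans (sym e) fx≡0)

  sum-map-≡0 : {f : A → ℕ} → ∀ xs → All (λ x → f x ≡ 0) xs → sum (map f xs) ≡ 0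
  sum-map-≡0 [] [] = refl
  sum-map-≡0 (x ∷ xs) (fx≡0 ∷ rest) = cong₂ _+_ fx≡0 (sum-map-≡0 xs rest)

  sum-map-≤1 : {f : A → ℕ} → (∀ x → f x ≤ 1) → (∀ {x y} → f x ≢ 0 → f y ≢ 0 → x ≡ y) →
               ∀ {xs} → Unique xs → sum (map f xs) ≤ 1
  sum-map-≤1 f≤1 supp {[]} [] = z≤n
  sum-map-≤1 {f} f≤1 supp {x ∷ xs} (x∉xs ∷ uniq) with f x ≟ 0
  ... | yes fx≡0 = begin
    f x + sum (map f xs)  ≡⟨ cong (_+ sum (map f xs)) fx≡0 ⟩
    sum (map f xs)        ≤⟨ sum-map-≤1 f≤1 supp uniq ⟩
    1                     ∎
    where open ≤-Reasoning
  ... | no fx≢0 = begin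
    f x + sum (map f xs)  ≡⟨ cong (f x +_) (sum-map-≡0 xs (zero-on xs x∉xs)) ⟩
    f x + 0               ≡⟨ +-identityʳ (f x) ⟩
    f x                   ≤⟨ f≤1 x ⟩
    1                     ∎
    where
    open ≤-Reasoning
    zero-on : ∀ ys → All (x ≢_) ys → All (λ y → f y ≡ 0) ys
    zero-on []       []           = []
    zero-on (y ∷ ys) (x≢y ∷ rest) with f y ≟ 0
    ... | yes fy≡0 = fy≡0 ∷ zero-on ys rest
    ... | no fy≢0  = contradiction (supp fx≢0 fy≢0) x≢y

module _ {n : ℕ} where

  Σ³ : (Fin n → Fin n → Fin n → ℕ) → ℕ
  Σ³ f = sum (map (λ a → sum (map (λ b → sum (map (λ c → f a b c) (allFin n))) (allFin n))) (allFin n))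

  Σ³-+ : {f g h : Fin n → Fin n → Fin n → ℕ} → (∀ a b c → f a b c ≡ g a b c + h a b c) →
         Σ³ f ≡ Σ³ g + Σ³ h
  Σ³-+ e = sum-map-+ (λ a → sum-map-+ (λ b → sum-map-+ (e a b) (allFin n)) (allFin n)) (allFin n)

  Σ³-≢0 : (f : Fin n → Fin n → Fin n → ℕ) → Σ³ f ≢ 0 → ∃ λ a → ∃ λ b → ∃ λ c → f a b c ≢ 0
  Σ³-≢0 f ne =
    let a , neᵃ = sum-map-≢0 _ (allFin n) ne
        b , neᵇ = sum-map-≢0 _ (allFin n) neᵃ
        c , neᶜ = sum-map-≢0 (f a b) (allFin n) neᵇ
    in a , b , c , neᶜ

module _ {n : ℕ} where

  Subsingleton : Subset n → Set
  Subsingleton X = ∀ {u v} → u ∈ X → v ∈ X → u ≡ v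

  record Partition (X X₁ X₂ : Subset n) : Set where
    field
      cover    : ∀ i → lookup X i ≡ lookup X₁ i ∨ lookup X₂ i
      disjoint : ∀ i → lookup X₁ i ∧ lookup X₂ i ≡ false
  open Partition public

  Disjoint-⊆ : ∀ {X X′ Y Y′ : Subset n} → X′ ⊆ X → Y′ ⊆ Y → Disjoint X Y → Disjoint X′ Y′
  Disjoint-⊆ {X′ = X′} {Y′ = Y′} X′⊆X Y′⊆Y disj (i , i∈X′∩Y′) =
    let i∈X′ , i∈Y′ = x∈p∩q⁻ X′ Y′ i∈X′∩Y′
    in disj (i , x∈p∩q⁺ (X′⊆X i∈X′ , Y′⊆Y i∈Y′))

ind-∨ : ∀ {x} x₁ x₂ r → x ≡ x₁ ∨ x₂ → x₁ ∧ x₂ ≡ false → ind (x ∧ r) ≡ ind (x₁ ∧ r) + ind (x₂ ∧ r)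
ind-∨ true  x₂ r refl disj rewrite disj = sym (+-identityʳ (ind r))
ind-∨ false x₂ r refl disj = refl

ind-∧ˡ : ∀ p {s s₁ s₂} → ind s ≡ ind s₁ + ind s₂ → ind (p ∧ s) ≡ ind (p ∧ s₁) + ind (p ∧ s₂)
ind-∧ˡ true  e = e
ind-∧ˡ false e = refl

ind-∧³-≢0 : ∀ x y z r → ind (x ∧ y ∧ z ∧ r) ≢ 0 → (x ≡ true) × (y ≡ true) × (z ≡ true)
ind-∧³-≢0 true  true  true  r ne = refl , refl , refl
ind-∧³-≢0 true  true  false r ne = contradiction refl ne
ind-∧³-≢0 true  false z     r ne = contradiction refl ne
ind-∧³-≢0 false y     z     r ne = contradiction refl ne

ind≤1 : ∀ b → ind b ≤ 1
ind≤1 true  = s≤s z≤n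
ind≤1 false = z≤n

module _ {n : ℕ} (G : Graph n) where

  isTri≢0 : ∀ A B C a b c → isTri G A B C a b c ≢ 0 → a ∈ A × b ∈ B × c ∈ C
  isTri≢0 A B C a b c ne =
    let a∈A , b∈B , c∈C = ind-∧³-≢0 (lookup A a) (lookup B b) (lookup C c) _ ne
    in lookup⇒[]= a A a∈A , lookup⇒[]= b B b∈B , lookup⇒[]= c C c∈C

  t≢0⇒nonempty : ∀ A B C → t G A B C ≢ 0 → Nonempty A × Nonempty B × Nonempty C
  t≢0⇒nonempty A B C ne =
    let a , b , c , neᵗ = Σ³-≢0 (isTri G A B C) ne
        a∈A , b∈B , c∈C = isTri≢0 A B C a b c neᵗ
    in (a , a∈A) , (b , b∈B) , (c , c∈C)

  t-partitionᴬ : ∀ {A A₁ A₂} B C → Partition A A₁ A₂ → t G A B C ≡ t G A₁ B C + t G A₂ B C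
  t-partitionᴬ {A₁ = A₁} {A₂} B C p = Σ³-+ λ a b c →
    ind-∨ (lookup A₁ a) (lookup A₂ a) _ (cover p a) (disjoint p a)

  t-partitionᴮ : ∀ A {B B₁ B₂} C → Partition B B₁ B₂ → t G A B C ≡ t G A B₁ C + t G A B₂ C
  t-partitionᴮ A {B₁ = B₁} {B₂} C p = Σ³-+ λ a b c →
    ind-∧ˡ (lookup A a) (ind-∨ (lookup B₁ b) (lookup B₂ b) _ (cover p b) (disjoint p b))

  t-partitionᶜ : ∀ A B {C C₁ C₂} → Partition C C₁ C₂ → t G A B C ≡ t G A B C₁ + t G A B C₂
  t-partitionᶜ A B {C₁ = C₁} {C₂} p = Σ³-+ λ a b c →
    ind-∧ˡ (lookup A a) (ind-∧ˡ (lookup B b) (ind-∨ (lookup C₁ c) (lookup C₂ c) _ (cover p c) (disjoint p c)))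

  t-subsingleton : ∀ {A B C} → Subsingleton A → Subsingleton B → Subsingleton C → t G A B C ≤ 1
  t-subsingleton {A} {B} {C} sA sB sC =
    sum-map-≤1 middle (λ ne ne′ → sA (inA ne) (inA ne′)) (allFin⁺ n)
    where
    inC : ∀ {a b c} → isTri G A B C a b c ≢ 0 → c ∈ C
    inC {a} {b} {c} ne = proj₂ (proj₂ (isTri≢0 A B C a b c ne))
    inner : ∀ a b → sum (map (isTri G A B C a b) (allFin n)) ≤ 1
    inner a b = sum-map-≤1 (λ c → ind≤1 _) (λ ne ne′ → sC (inC ne) (inC ne′)) (allFin⁺ n)
    inB : ∀ {a b} → sum (map (isTri G A B C a b) (allFin n)) ≢ 0 → b ∈ B
    inB {a} {b} ne = let c , neᶜ = sum-map-≢0 (isTri G A B C a b) (allFin n) ne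
                     in proj₁ (proj₂ (isTri≢0 A B C a b c neᶜ))
    middle : ∀ a → sum (map (λ b → sum (map (isTri G A B C a b) (allFin n))) (allFin n)) ≤ 1
    middle a = sum-map-≤1 (inner a) (λ ne ne′ → sB (inB ne) (inB ne′)) (allFin⁺ n)
    inA : ∀ {a} → sum (map (λ b → sum (map (isTri G A B C a b) (allFin n))) (allFin n)) ≢ 0 → a ∈ A
    inA {a} ne = let b , neᵇ = sum-map-≢0 _ (allFin n) ne
                     c , neᶜ = sum-map-≢0 (isTri G A B C a b) (allFin n) neᵇ
                 in proj₁ (isTri≢0 A B C a b c neᶜ)

validQuery? : ∀ {n} (V₁ V₂ V₃ : Subset n) → Dec (ValidQuery V₁ V₂ V₃)
validQuery? V₁ V₂ V₃ =
  nonempty? V₁ ×-dec nonempty? V₂ ×-dec nonempty? V₃ ×-dec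
  ¬? (nonempty? (V₁ ∩ V₂)) ×-dec ¬? (nonempty? (V₂ ∩ V₃)) ×-dec ¬? (nonempty? (V₁ ∩ V₃))

-- An invalid query on pairwise disjoint sets has an empty part, so its answer
-- is NO and need not be asked.
askTIS : ∀ {n} (V₁ V₂ V₃ : Subset n) (onYes onNo : QTree n) → QTree n
askTIS V₁ V₂ V₃ onYes onNo with validQuery? V₁ V₂ V₃
... | yes valid = query V₁ V₂ V₃ valid onYes onNo
... | no _      = onNo

⊓-+ : ∀ k p q → k ⊓ (p + q) ≡ k ⊓ p + (k ∸ k ⊓ p) ⊓ q
⊓-+ zero    p       q = refl
⊓-+ (suc k) zero    q = refl
⊓-+ (suc k) (suc p) q = cong suc (⊓-+ k p q)

split-cost : ∀ d a b m q → a + b ≡ suc m →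
             suc (1 + 2 * d * a + (1 + 2 * d * b + q)) ≤ 1 + 2 * suc d * suc m + q
split-cost d a b m q e = begin
  suc (1 + 2 * d * a + (1 + 2 * d * b + q))  ≡⟨ regroup d a b q ⟩
  3 + 2 * d * (a + b) + q                    ≡⟨ cong (λ s → 3 + 2 * d * s + q) e ⟩
  3 + 2 * d * suc m + q                      ≤⟨ m≤n+m _ (2 * m) ⟩
  2 * m + (3 + 2 * d * suc m + q)            ≡⟨ expand d m q ⟩
  1 + 2 * suc d * suc m + q                  ∎
  where
  open ≤-Reasoning
  regroup : ∀ d a b q → suc (1 + 2 * d * a + (1 + 2 * d * b + q)) ≡ 3 + 2 * d * (a + b) + q
  regroup = solve-∀
  expand : ∀ d m q → 2 * m + (3 + 2 * d * suc m + q) ≡ 1 + 2 * suc d * suc m + q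
  expand = solve-∀

-- A depth-d binary subdivision of the cell x; the cells of the subdivision are
-- its type indices.
data Splitting (X : Set) : ℕ → X → Set where
  atom  : ∀ {x} → Splitting X zero x
  split : ∀ {d x y z} → Splitting X d y → Splitting X d z → Splitting X (suc d) x

module CappedCount {n : ℕ} {X : Set} (test : X → QTree n → QTree n → QTree n) where

  -- Continuation-passing, since a QTree only outputs Booleans: κ receives the
  -- count capped at k.
  count : ∀ {d x} → ℕ → Splitting X d x → (ℕ → QTree n) → QTree n
  count zero    _                   κ = κ 0
  count (suc k) (atom {x = x})      κ = test x (κ 1) (κ 0)
  count (suc k) (split {x = x} l r) κ =
    test x (count (suc k) l λ a → count (suc k ∸ a) r λ b → κ (a + b)) (κ 0)

  module _ (G : Graph n) (w : X → ℕ) where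

    BehavesAs : Bool → QTree n → QTree n → QTree n → Set
    BehavesAs answer q y z =
      run G q ≡ (if answer then run G y else run G z) ×
      queries G q ≤ suc (if answer then queries G y else queries G z)

    IsZeroTest : X → Set
    IsZeroTest x = ∀ y z → BehavesAs (not (w x ≡ᵇ 0)) (test x y z) y z

    Counts : ∀ {d x} → Splitting X d x → Set
    Counts (atom {x = x}) = IsZeroTest x × w x ≤ 1
    Counts (split {x = x} {y} {z} l r) = IsZeroTest x × w x ≡ w y + w z × Counts l × Counts r

    test-zero : ∀ {x} → IsZeroTest x → w x ≡ 0 → ∀ y z →
                run G (test x y z) ≡ run G z × queries G (test x y z) ≤ suc (queries G z)
    test-zero zt e y z = subst (λ m → BehavesAs (not (m ≡ᵇ 0)) _ y z) e (zt y z)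

    test-nonzero : ∀ {x m} → IsZeroTest x → w x ≡ suc m → ∀ y z →
                   run G (test x y z) ≡ run G y × queries G (test x y z) ≤ suc (queries G y)
    test-nonzero zt e y z = subst (λ m → BehavesAs (not (m ≡ᵇ 0)) _ y z) e (zt y z)

    capped-sum : ∀ k {x y z m} → w x ≡ w y + w z → w x ≡ suc m →
                 suc k ⊓ w y + (suc k ∸ suc k ⊓ w y) ⊓ w z ≡ suc (k ⊓ m)
    capped-sum k {y = y} {z} additive e =
      trans (sym (⊓-+ (suc k) (w y) (w z))) (cong (suc k ⊓_) (trans (sym additive) e))

    count-run : ∀ {d x} (h : Splitting X d x) → Counts h → ∀ k κ →
                run G (count k h κ) ≡ run G (κ (k ⊓ w x))
    count-run _ _ zero κ = refl
    count-run (atom {x = x}) (zt , w≤1) (suc k) κ = by-weight (w x) refl w≤1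
      where
      by-weight : ∀ m → w x ≡ m → m ≤ 1 → run G (test x (κ 1) (κ 0)) ≡ run G (κ (suc k ⊓ m))
      by-weight zero          e _ = proj₁ (test-zero zt e _ _)
      by-weight (suc zero)    e _ =
        trans (proj₁ (test-nonzero zt e _ _)) (cong (λ m → run G (κ (suc m))) (sym (⊓-zeroʳ k)))
      by-weight (suc (suc _)) _ (s≤s ())
    count-run (split {x = x} {y} {z} l r) (zt , additive , cl , cr) (suc k) κ = by-weight (w x) refl
      where
      a = suc k ⊓ w y
      κ′ = λ a → count (suc k ∸ a) r λ b → κ (a + b)
      by-weight : ∀ m → w x ≡ m → run G (test x (count (suc k) l κ′) (κ 0)) ≡ run G (κ (suc k ⊓ m))
      by-weight zero    e = proj₁ (test-zero zt e _ _)
      by-weight (suc m) e = begin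
        run G (test x (count (suc k) l κ′) (κ 0))  ≡⟨ proj₁ (test-nonzero zt e _ _) ⟩
        run G (count (suc k) l κ′)                 ≡⟨ count-run l cl (suc k) κ′ ⟩
        run G (κ′ a)                               ≡⟨ count-run r cr (suc k ∸ a) _ ⟩
        run G (κ (a + (suc k ∸ a) ⊓ w z))          ≡⟨ cong (run G ∘ κ) (capped-sum k additive e) ⟩
        run G (κ (suc k ⊓ suc m))                  ∎
        where open ≡-Reasoning

    count-queries : ∀ {d x} (h : Splitting X d x) → Counts h → ∀ k κ →
                    queries G (count k h κ) ≤ 1 + 2 * d * (k ⊓ w x) + queries G (κ (k ⊓ w x))
    count-queries {d} _ _ zero κ = m≤n+m _ (1 + 2 * d * 0)
    count-queries (atom {x = x}) (zt , w≤1) (suc k) κ = by-weight (w x) refl w≤1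
      where
      by-weight : ∀ m → w x ≡ m → m ≤ 1 →
                  queries G (test x (κ 1) (κ 0)) ≤ suc (queries G (κ (suc k ⊓ m)))
      by-weight zero          e _ = proj₂ (test-zero zt e _ _)
      by-weight (suc zero)    e _ =
        subst (λ m → queries G (test x (κ 1) (κ 0)) ≤ suc (queries G (κ (suc m))))
              (sym (⊓-zeroʳ k)) (proj₂ (test-nonzero zt e _ _))
      by-weight (suc (suc _)) _ (s≤s ())
    count-queries {suc d} (split {x = x} {y} {z} l r) (zt , additive , cl , cr) (suc k) κ =
      by-weight (w x) refl
      where
      a = suc k ⊓ w y
      b = (suc k ∸ a) ⊓ w z
      κ′ = λ a → count (suc k ∸ a) r λ b → κ (a + b)
      by-weight : ∀ m → w x ≡ m → queries G (test x (count (suc k) l κ′) (κ 0))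
                                  ≤ 1 + 2 * suc d * (suc k ⊓ m) + queries G (κ (suc k ⊓ m))
      by-weight zero    e = ≤-trans (proj₂ (test-zero zt e _ _)) (+-monoˡ-≤ _ (s≤s z≤n))
      by-weight (suc m) e = begin
        queries G (test x (count (suc k) l κ′) (κ 0))          ≤⟨ proj₂ (test-nonzero zt e _ _) ⟩
        suc (queries G (count (suc k) l κ′))                  ≤⟨ s≤s (count-queries l cl (suc k) κ′) ⟩
        suc (1 + 2 * d * a + queries G (κ′ a))
          ≤⟨ s≤s (+-monoʳ-≤ _ (count-queries r cr (suc k ∸ a) _)) ⟩
        suc (1 + 2 * d * a + (1 + 2 * d * b + queries G (κ (a + b))))
          ≡⟨ cong (λ s → suc (1 + 2 * d * a + (1 + 2 * d * b + queries G (κ s)))) a+b≡ ⟩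
        suc (1 + 2 * d * a + (1 + 2 * d * b + queries G (κ (suc (k ⊓ m)))))
          ≤⟨ split-cost d a b (k ⊓ m) _ a+b≡ ⟩
        1 + 2 * suc d * suc (k ⊓ m) + queries G (κ (suc (k ⊓ m)))  ∎
        where
        open ≤-Reasoning
        a+b≡ : a + b ≡ suc (k ⊓ m)
        a+b≡ = capped-sum k additive e

⌊_/2^_⌋ : ℕ → ℕ → ℕ
⌊ x /2^ zero  ⌋ = x
⌊ x /2^ suc ℓ ⌋ = ⌊ ⌊ x /2⌋ /2^ ℓ ⌋

⌊/2^suc⌋ : ∀ x ℓ → ⌊ x /2^ suc ℓ ⌋ ≡ ⌊ ⌊ x /2^ ℓ ⌋ /2⌋
⌊/2^suc⌋ x zero    = refl
⌊/2^suc⌋ x (suc ℓ) = ⌊/2^suc⌋ ⌊ x /2⌋ ℓ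

⌊/2⌋≡ᵇ : ∀ y j → (⌊ y /2⌋ ≡ᵇ j) ≡ (y ≡ᵇ 2 * j) ∨ (y ≡ᵇ 1 + 2 * j)
⌊/2⌋≡ᵇ zero          zero    = refl
⌊/2⌋≡ᵇ zero          (suc j) = refl
⌊/2⌋≡ᵇ (suc zero)    zero    = refl
⌊/2⌋≡ᵇ (suc zero)    (suc j) rewrite +-suc j (j + 0) = refl
⌊/2⌋≡ᵇ (suc (suc y)) zero    = refl
⌊/2⌋≡ᵇ (suc (suc y)) (suc j) rewrite +-suc j (j + 0) = ⌊/2⌋≡ᵇ y j

≡ᵇ-even-odd : ∀ y j → (y ≡ᵇ 2 * j) ∧ (y ≡ᵇ 1 + 2 * j) ≡ false
≡ᵇ-even-odd zero          zero    = refl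
≡ᵇ-even-odd zero          (suc j) = refl
≡ᵇ-even-odd (suc zero)    zero    = refl
≡ᵇ-even-odd (suc zero)    (suc j) rewrite +-suc j (j + 0) = refl
≡ᵇ-even-odd (suc (suc y)) zero    = refl
≡ᵇ-even-odd (suc (suc y)) (suc j) rewrite +-suc j (j + 0) = ≡ᵇ-even-odd y j

⌊/2^⌈log2⌉⌋≡0 : ∀ {n} (rec : Acc _<_ n) x → x < n → ⌊ x /2^ ⌈log2⌉ n rec ⌋ ≡ 0
⌊/2^⌈log2⌉⌋≡0 {suc zero}    _         zero    _         = refl
⌊/2^⌈log2⌉⌋≡0 {suc zero}    _         (suc _) (s≤s ())
⌊/2^⌈log2⌉⌋≡0 {suc (suc m)} (acc rec) x (s≤s x≤1+m) =
  ⌊/2^⌈log2⌉⌋≡0 (rec (⌈n/2⌉<n m)) ⌊ x /2⌋ (s≤s (⌊n/2⌋-mono x≤1+m))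

module _ {n : ℕ} where

  block : Subset n → ℕ → ℕ → Subset n
  block X ℓ j = tabulate λ i → lookup X i ∧ (⌊ toℕ i /2^ ℓ ⌋ ≡ᵇ j)

  lookup-block : ∀ X ℓ j i → lookup (block X ℓ j) i ≡ lookup X i ∧ (⌊ toℕ i /2^ ℓ ⌋ ≡ᵇ j)
  lookup-block X ℓ j = lookup∘tabulate _

  block-partition : ∀ X ℓ j → Partition (block X (suc ℓ) j) (block X ℓ (2 * j)) (block X ℓ (1 + 2 * j))
  block-partition X ℓ j = record { cover = cover′ ; disjoint = disjoint′ }
    where
    open ≡-Reasoning
    x : Fin n → Bool
    x i = lookup X i
    y : Fin n → ℕ
    y i = ⌊ toℕ i /2^ ℓ ⌋
    cover′ : ∀ i → lookup (block X (suc ℓ) j) i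
                   ≡ lookup (block X ℓ (2 * j)) i ∨ lookup (block X ℓ (1 + 2 * j)) i
    cover′ i = begin
      lookup (block X (suc ℓ) j) i                ≡⟨ lookup-block X (suc ℓ) j i ⟩
      x i ∧ (⌊ toℕ i /2^ suc ℓ ⌋ ≡ᵇ j)            ≡⟨ cong (λ v → x i ∧ (v ≡ᵇ j)) (⌊/2^suc⌋ (toℕ i) ℓ) ⟩
      x i ∧ (⌊ y i /2⌋ ≡ᵇ j)                      ≡⟨ cong (x i ∧_) (⌊/2⌋≡ᵇ (y i) j) ⟩
      x i ∧ ((y i ≡ᵇ 2 * j) ∨ (y i ≡ᵇ 1 + 2 * j))  ≡⟨ ∧-distribˡ-∨ (x i) _ _ ⟩
      x i ∧ (y i ≡ᵇ 2 * j) ∨ x i ∧ (y i ≡ᵇ 1 + 2 * j)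
        ≡⟨ sym (cong₂ _∨_ (lookup-block X ℓ _ i) (lookup-block X ℓ _ i)) ⟩
      lookup (block X ℓ (2 * j)) i ∨ lookup (block X ℓ (1 + 2 * j)) i ∎
    ∧-both : ∀ b {p q} → p ∧ q ≡ false → (b ∧ p) ∧ (b ∧ q) ≡ false
    ∧-both true  e = e
    ∧-both false _ = refl
    disjoint′ : ∀ i → lookup (block X ℓ (2 * j)) i ∧ lookup (block X ℓ (1 + 2 * j)) i ≡ false
    disjoint′ i = begin
      lookup (block X ℓ (2 * j)) i ∧ lookup (block X ℓ (1 + 2 * j)) i
        ≡⟨ cong₂ _∧_ (lookup-block X ℓ _ i) (lookup-block X ℓ _ i) ⟩
      (x i ∧ (y i ≡ᵇ 2 * j)) ∧ (x i ∧ (y i ≡ᵇ 1 + 2 * j))  ≡⟨ ∧-both (x i) (≡ᵇ-even-odd (y i) j) ⟩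
      false                                              ∎

  ∈-block : ∀ X ℓ j {i} → i ∈ block X ℓ j → i ∈ X × ⌊ toℕ i /2^ ℓ ⌋ ≡ j
  ∈-block X ℓ j {i} i∈ =
    lookup⇒[]= i X (∧-conicalˡ _ _ both) , ≡ᵇ⇒≡ _ j (subst T (sym (∧-conicalʳ _ _ both)) tt)
    where
    both : lookup X i ∧ (⌊ toℕ i /2^ ℓ ⌋ ≡ᵇ j) ≡ true
    both = trans (sym (lookup-block X ℓ j i)) ([]=⇒lookup i∈)

  block-⊆ : ∀ X ℓ j → block X ℓ j ⊆ X
  block-⊆ X ℓ j = proj₁ ∘ ∈-block X ℓ j

  block-subsingleton : ∀ X j → Subsingleton (block X 0 j)
  block-subsingleton X j u∈ v∈ =
    toℕ-injective (trans (proj₂ (∈-block X 0 j u∈)) (sym (proj₂ (∈-block X 0 j v∈))))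

  block-top : ∀ X → block X ⌈log₂ n ⌉ 0 ≡ X
  block-top X = begin
    tabulate (λ i → lookup X i ∧ (⌊ toℕ i /2^ ⌈log₂ n ⌉ ⌋ ≡ᵇ 0))
      ≡⟨ tabulate-cong (λ i → cong (λ v → lookup X i ∧ (v ≡ᵇ 0)) (top≡0 i)) ⟩
    tabulate (λ i → lookup X i ∧ true)  ≡⟨ tabulate-cong (λ i → ∧-identityʳ (lookup X i)) ⟩
    tabulate (lookup X)                 ≡⟨ tabulate∘lookup X ⟩
    X                                   ∎
    where
    open ≡-Reasoning
    top≡0 : ∀ i → ⌊ toℕ i /2^ ⌈log₂ n ⌉ ⌋ ≡ 0
    top≡0 i = ⌊/2^⌈log2⌉⌋≡0 (<-wellFounded n) (toℕ i) (toℕ<n i)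

Triple : ℕ → Set
Triple n = Subset n × Subset n × Subset n

module TriangleCount {n : ℕ} = CappedCount {n} {Triple n} (λ (V₁ , V₂ , V₃) → askTIS V₁ V₂ V₃)
open TriangleCount

triangles : ∀ {n} → Graph n → Triple n → ℕ
triangles G (V₁ , V₂ , V₃) = t G V₁ V₂ V₃

askTIS-isZeroTest : ∀ {n} (G : Graph n) {V₁ V₂ V₃} → PairwiseDisjoint V₁ V₂ V₃ →
                    IsZeroTest G (triangles G) (V₁ , V₂ , V₃)
askTIS-isZeroTest G {V₁} {V₂} {V₃} disj y z with validQuery? V₁ V₂ V₃
... | yes _     = refl , ≤-refl
... | no ¬valid with t G V₁ V₂ V₃ ≟ 0
...   | yes t≡0 rewrite t≡0 = refl , n≤1+n _
...   | no t≢0  = let ne₁ , ne₂ , ne₃ = t≢0⇒nonempty G V₁ V₂ V₃ t≢0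
                  in contradiction (ne₁ , ne₂ , ne₃ , disj) ¬valid

module _ {n : ℕ} (A B C : Subset n) where

  cell : ℕ → ℕ → ℕ → ℕ → ℕ → ℕ → Triple n
  cell ℓa ja ℓb jb ℓc jc = block A ℓa ja , block B ℓb jb , block C ℓc jc

  blocks : ∀ ℓa ja ℓb jb ℓc jc → Splitting (Triple n) (ℓa + ℓb + ℓc) (cell ℓa ja ℓb jb ℓc jc)
  blocks (suc ℓa) ja ℓb jb ℓc jc = split (blocks ℓa (2 * ja) ℓb jb ℓc jc) (blocks ℓa (1 + 2 * ja) ℓb jb ℓc jc)
  blocks zero ja (suc ℓb) jb ℓc jc = split (blocks 0 ja ℓb (2 * jb) ℓc jc) (blocks 0 ja ℓb (1 + 2 * jb) ℓc jc)
  blocks zero ja zero jb (suc ℓc) jc = split (blocks 0 ja 0 jb ℓc (2 * jc)) (blocks 0 ja 0 jb ℓc (1 + 2 * jc))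
  blocks zero ja zero jb zero jc = atom

  module _ (disj : PairwiseDisjoint A B C) (G : Graph n) where

    cell-isZeroTest : ∀ ℓa ja ℓb jb ℓc jc → IsZeroTest G (triangles G) (cell ℓa ja ℓb jb ℓc jc)
    cell-isZeroTest ℓa ja ℓb jb ℓc jc =
      let AB , BC , AC = disj
          ⊆A = block-⊆ A ℓa ja ; ⊆B = block-⊆ B ℓb jb ; ⊆C = block-⊆ C ℓc jc
      in askTIS-isZeroTest G (Disjoint-⊆ ⊆A ⊆B AB , Disjoint-⊆ ⊆B ⊆C BC , Disjoint-⊆ ⊆A ⊆C AC)

    blocks-counts : ∀ ℓa ja ℓb jb ℓc jc → Counts G (triangles G) (blocks ℓa ja ℓb jb ℓc jc)
    blocks-counts (suc ℓa) ja ℓb jb ℓc jc =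
      cell-isZeroTest (suc ℓa) ja ℓb jb ℓc jc ,
      t-partitionᴬ G (block B ℓb jb) (block C ℓc jc) (block-partition A ℓa ja) ,
      blocks-counts ℓa (2 * ja) ℓb jb ℓc jc , blocks-counts ℓa (1 + 2 * ja) ℓb jb ℓc jc
    blocks-counts zero ja (suc ℓb) jb ℓc jc =
      cell-isZeroTest 0 ja (suc ℓb) jb ℓc jc ,
      t-partitionᴮ G (block A 0 ja) (block C ℓc jc) (block-partition B ℓb jb) ,
      blocks-counts 0 ja ℓb (2 * jb) ℓc jc , blocks-counts 0 ja ℓb (1 + 2 * jb) ℓc jc
    blocks-counts zero ja zero jb (suc ℓc) jc =
      cell-isZeroTest 0 ja 0 jb (suc ℓc) jc ,
      t-partitionᶜ G (block A 0 ja) (block B 0 jb) (block-partition C ℓc jc) ,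
      blocks-counts 0 ja 0 jb ℓc (2 * jc) , blocks-counts 0 ja 0 jb ℓc (1 + 2 * jc)
    blocks-counts zero ja zero jb zero jc =
      cell-isZeroTest 0 ja 0 jb 0 jc ,
      t-subsingleton G (block-subsingleton A ja) (block-subsingleton B jb) (block-subsingleton C jc)

suc-≤ᵇ-suc : ∀ a b → (suc a ≤ᵇ suc b) ≡ (a ≤ᵇ b)
suc-≤ᵇ-suc zero    b = refl
suc-≤ᵇ-suc (suc a) b = refl

capped-≤ᵇ : ∀ τ x → (suc τ ⊓ x ≤ᵇ τ) ≡ (x ≤ᵇ τ)
capped-≤ᵇ zero    zero    = refl
capped-≤ᵇ zero    (suc x) = refl
capped-≤ᵇ (suc τ) zero    = refl
capped-≤ᵇ (suc τ) (suc x) = begin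
  suc (suc τ ⊓ x) ≤ᵇ suc τ  ≡⟨ suc-≤ᵇ-suc (suc τ ⊓ x) τ ⟩
  suc τ ⊓ x ≤ᵇ τ            ≡⟨ capped-≤ᵇ τ x ⟩
  x ≤ᵇ τ                    ≡⟨ suc-≤ᵇ-suc x τ ⟨
  suc x ≤ᵇ suc τ            ∎
  where open ≡-Reasoning

total-cost : ∀ D τ m → m ≤ suc τ → 1 + 2 * (D + D + D) * m + 0 ≤ 6 * suc τ * suc D
total-cost D τ m m≤1+τ = begin
  1 + 2 * (D + D + D) * m + 0                    ≤⟨ +-monoˡ-≤ 0 (s≤s (*-monoʳ-≤ (2 * (D + D + D)) m≤1+τ)) ⟩
  1 + 2 * (D + D + D) * suc τ + 0                ≤⟨ m≤m+n _ (5 + 6 * τ) ⟩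
  1 + 2 * (D + D + D) * suc τ + 0 + (5 + 6 * τ)  ≡⟨ expand D τ ⟩
  6 * suc τ * suc D                              ∎
  where
  open ≤-Reasoning
  expand : ∀ D τ → 1 + 2 * (D + D + D) * suc τ + 0 + (5 + 6 * τ) ≡ 6 * suc τ * suc D
  expand = solve-∀

t-blocks-top : ∀ {n} (G : Graph n) A B C →
               let D = ⌈log₂ n ⌉ in t G (block A D 0) (block B D 0) (block C D 0) ≡ t G A B C
t-blocks-top G A B C rewrite block-top A | block-top B | block-top C = refl

triangles≤? : (n τ : ℕ) (A B C : Subset n) → QTree n
triangles≤? n τ A B C = count (suc τ) (blocks A B C D 0 D 0 D 0) λ m → leaf (m ≤ᵇ τ)
  where D = ⌈log₂ n ⌉

module _ (n τ : ℕ) (A B C : Subset n) (disj : PairwiseDisjoint A B C) (G : Graph n) where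

  private
    D = ⌈log₂ n ⌉
    counts = blocks-counts A B C disj G D 0 D 0 D 0

  triangles≤?-run : run G (triangles≤? n τ A B C) ≡ (t G A B C ≤ᵇ τ)
  triangles≤?-run = begin
    run G (triangles≤? n τ A B C)
      ≡⟨ count-run G (triangles G) _ counts (suc τ) _ ⟩
    suc τ ⊓ t G (block A D 0) (block B D 0) (block C D 0) ≤ᵇ τ
      ≡⟨ cong (λ s → suc τ ⊓ s ≤ᵇ τ) (t-blocks-top G A B C) ⟩
    suc τ ⊓ t G A B C ≤ᵇ τ
      ≡⟨ capped-≤ᵇ τ (t G A B C) ⟩
    t G A B C ≤ᵇ τ
      ∎
    where open ≡-Reasoning

  triangles≤?-queries : queries G (triangles≤? n τ A B C) ≤ 6 * suc τ * suc D
  triangles≤?-queries =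
    ≤-trans (count-queries G (triangles G) _ counts (suc τ) _) (total-cost D τ _ (m⊓n≤m (suc τ) _))

lemma3 : Σ[ alg ∈ ((n : ℕ) → (τ : ℕ) → (A B C : Subset n) → QTree n) ]
           Σ[ c ∈ ℕ ]
             ((n τ : ℕ) (A B C : Subset n) → PairwiseDisjoint A B C →
              (G : Graph n) →
              (run G (alg n τ A B C) ≡ (t G A B C ≤ᵇ τ))
              × (queries G (alg n τ A B C) ≤ c * suc τ * suc ⌈log₂ n ⌉))
lemma3 = triangles≤? , 6 , λ n τ A B C disj G →
  triangles≤?-run n τ A B C disj G , triangles≤?-queries n τ A B C disj G
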